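{- Let $k \ge 3$ be an integer and let $n$ be a prime with $n \ge k^2 - k$. Then there exists a graph $G$ with $\Delta(G) = n + k - 1$ and $\mathrm{mad}(G) < 2k$ such that $G^2$ contains a clique on $k\Delta(G) + k$ vertices; in particular $\chi(G^2) \ge k\Delta(G) + k$.
   Context: For a graph $G$, $\Delta(G)$ is its maximum degree and $\chi$ denotes chromatic number. The square $G^2$ of $G$ is the graph on $V(G)$ in which two distinct vertices are adjacent iff their distance in $G$ is at most $2$. The maximum average degree $\mathrm{mad}(G)$ is the maximum, over all subgraphs $H$ of $G$ with $V(H)\neq\emptyset$, of $2|E(H)|/|V(H)|$. -}

module Defs where

open import Data.Nat using (ℕ; zero; suc; _+_; _*_; _⊔_; _<_; _≤_)
open import Data.Bool using (Bool; true; false; if_then_else_; _∧_)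
open import Data.Fin using (Fin)
open import Data.List using (List; map; foldr; allFin)
open import Data.Nat.ListAction using (sum)
open import Data.Sum using (_⊎_)
open import Data.Product using (Σ; ∃; _×_)
open import Relation.Binary.PropositionalEquality using (_≡_; _≢_)
open import Relation.Nullary using (¬_)

record Graph : Set where
  field
    N     : ℕ
    adj   : Fin N → Fin N → Bool
    sym   : ∀ i j → adj i j ≡ adj j i
    irrefl : ∀ i → adj i i ≡ false

open Graph public

count : {N : ℕ} → (Fin N → Bool) → ℕ
count {N} p = sum (map (λ j → if p j then 1 else 0) (allFin N))

deg : (G : Graph) → Fin (N G) → ℕ
deg G i = count (adj G i)

Δ : Graph → ℕ
Δ G = foldr _⊔_ 0 (map (deg G) (allFin (N G)))

-- A vertex subset S (as a Boolean predicate).  twiceEdges G S = 2|E(G[S])|,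
-- counting ordered adjacent pairs (i , j) with i , j ∈ S.
twiceEdges : (G : Graph) → (Fin (N G) → Bool) → ℕ
twiceEdges G S = sum (map (λ i → if S i then count (λ j → S j ∧ adj G i j) else 0) (allFin (N G)))

-- mad(G) < r  for a natural number r :
-- every subgraph H with V(H) ≠ ∅ has 2|E(H)|/|V(H)| < r, i.e. 2|E(H)| < r·|V(H)|.
-- (It suffices to range over induced subgraphs G[S], since any subgraph on
--  vertex set S has at most |E(G[S])| edges.)
madLessThan : Graph → ℕ → Set
madLessThan G r = (S : Fin (N G) → Bool) → 0 < count S → twiceEdges G S < r * count S

adj² : (G : Graph) → Fin (N G) → Fin (N G) → Set
adj² G u v = u ≢ v × (adj G u v ≡ true ⊎ ∃ λ w → adj G u w ≡ true × adj G w v ≡ true)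

HasSquareClique : (G : Graph) → ℕ → Set
HasSquareClique G m =
  Σ (Fin m → Fin (N G)) λ f → ∀ a b → a ≢ b → adj² G (f a) (f b)

ProperColouring² : (G : Graph) → (c : ℕ) → (Fin (N G) → Fin c) → Set
ProperColouring² G c col = ∀ u v → adj² G u v → col u ≢ col v

χ²≥ : Graph → ℕ → Set
χ²≥ G m = ∀ c (col : Fin (N G) → Fin c) → ProperColouring² G c col → m ≤ c

-- G lives on the grid Fin k × ℤ/n. It has a vertex for every point (i , a), a vertex for every column i,
-- joined to the n points of the column and to the other columns, and a vertex for every line
-- a = s + t·i (s, t ∈ ℤ/n), joined to its k points. Writing n = k(k−1) + m₀, the slopes t < k(k−1) are
-- shallow and split into k classes of k−1; the line through the origin with a shallow slope is also joined
-- to the other lines of that slope. Columns have the maximum degree Δ = n + k − 1.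
-- Since n is prime, two points in different columns lie on a common line, so the points, the columns and
-- the shallow lines through the origin are pairwise at distance at most 2: a clique of size
-- kn + k + k(k−1) = kΔ + k in G².
-- For mad(G) < 2k, orient the edges so that every in-degree is at most k, the edge between a line with
-- non-zero intercept and shallow slope of class c and its point in column c pointing to the point. Every
-- non-empty S ⊆ V(G) contains a vertex with at most k − 1 in-neighbours in S, so
-- 2|E(G[S])| ≤ 2 Σ_{v ∈ S} indeg_S(v) < 2k|S|.

module Submission where

open import Defs hiding (sym)
open import Data.Bool using (Bool; true; false; if_then_else_; _∧_; _∨_; T)
open import Data.Bool.Properties using (∨-comm)
open import Data.Empty using (⊥-elim)
open import Data.Fin as Fin using (Fin; zero; suc; toℕ; fromℕ<; punchOut; punchIn; _≟_)
open import Data.Fin.Properties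
  using ( toℕ<n; toℕ-injective; toℕ-fromℕ<; fromℕ<-injective; suc-injective; 0≢1+n; ¬Fin0; any?
        ; punchOut-injective; punchIn-injective; punchIn-punchOut; punchInᵢ≢i; injective⇒≤; +↔⊎; *↔×)
open import Data.List using (foldr; map; allFin; tabulate)
open import Data.List.Properties using (map-tabulate)
open import Data.Nat as ℕ using (ℕ; zero; suc; _+_; _*_; _∸_; _⊔_; _≤_; _<_; _%_; pred; NonZero; z≤n; s≤s)
open import Data.Nat.Coprimality using (prime⇒coprime; coprime-Bézout)
open import Data.Nat.DivMod using (_mod_; m%n%n≡m%n; %-distribˡ-+; %-distribˡ-*; [m+kn]%n≡m%n; m<n⇒m%n≡m; m%n<n; m%n≤n)
open import Data.Nat.GCD using (module Bézout)
open import Data.Nat.ListAction using (sum)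
open import Data.Nat.Primality using (Prime)
open import Data.Nat.Properties
  using ( +-*-semiring; +-comm; +-assoc; +-suc; +-identityʳ; *-comm; *-assoc; *-identityˡ; *-identityʳ; *-zeroʳ
        ; *-distribˡ-+; *-distribˡ-∸; m+[n∸m]≡n; m∸n≤m; +-cancelˡ-≡
        ; ≤-refl; ≤-reflexive; ≤-trans; ≤-antisym; ≤-pred; <-irrefl; <-trans; <-≤-trans; <⇒≢; ≤-<-trans; <-cmp; <⇒≤; <⇒≱
        ; m≤m+n; m≤n+m; m<m+n; m≤m*n; m<n⇒m<1+n; m<n⇒0<n∸m; m≤m⊔n; m≤n⊔m; ⊔-lub
        ; +-mono-≤; +-mono-<-≤; +-mono-≤-<; +-monoʳ-<; *-monoʳ-<; module ≤-Reasoning)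
open import Data.Nat.Tactic.RingSolver using (solve-∀)
open import Algebra.Properties.Semiring.Sum +-*-semiring
  using (sum-syntax; sum-cong-≗; sum-replicate-zero; ∑-distrib-+; ∑-comm; *-distribˡ-sum)
  renaming (sum to ∑)
open import Data.Product using (Σ; ∃; ∃₂; _×_; _,_; uncurry)
open import Data.Product.Function.NonDependent.Propositional using (_×-↔_)
open import Data.Sum using (_⊎_; inj₁; inj₂)
open import Data.Sum.Function.Propositional using (_⊎-↔_)
open import Data.Unit using (tt)
open import Data.Vec.Functional as Vector using ()
open import Function using (_∘_; id)
open import Function.Bundles using (_↔_; Inverse; mk↔ₛ′)
open import Function.Properties.Inverse using (↔-refl; ↔-sym; ↔-trans)
open import Relation.Binary using (Setoid; IsEquivalence; tri<; tri≈; tri>)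
import Relation.Binary.Reasoning.Setoid as SetoidReasoning
open import Relation.Binary.PropositionalEquality
open import Relation.Nullary using (Dec; yes; no; does; ¬_)
open import Relation.Nullary.Decidable using (T?; map′; ¬?; _×-dec_; _⊎-dec_; dec-true; dec-false)
open import Relation.Unary using (Decidable)

-- Counting over Fin

indicator : Bool → ℕ
indicator b = if b then 1 else 0

foldr-map-allFin : ∀ {A : Set} (_∙_ : A → A → A) (e : A) {N} (f : Fin N → A) →
  foldr _∙_ e (map f (allFin N)) ≡ Vector.foldr _∙_ e f
foldr-map-allFin _∙_ e {N} f = trans (cong (foldr _∙_ e) (map-tabulate id f)) (go f)
  where
  go : ∀ {N} (f : Fin N → _) → foldr _∙_ e (tabulate f) ≡ Vector.foldr _∙_ e f
  go {zero} f = refl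
  go {suc N} f = cong (f zero ∙_) (go (f ∘ suc))

sum-map-allFin : ∀ {N} (f : Fin N → ℕ) → sum (map f (allFin N)) ≡ ∑[ i < N ] f i
sum-map-allFin = foldr-map-allFin _+_ 0

count≡∑ : ∀ {N} (p : Fin N → Bool) → count p ≡ ∑[ i < N ] indicator (p i)
count≡∑ p = sum-map-allFin (indicator ∘ p)

count-suc : ∀ {N} (p : Fin (suc N) → Bool) → count p ≡ indicator (p zero) + count (p ∘ suc)
count-suc p = trans (count≡∑ p) (cong (indicator (p zero) +_) (sym (count≡∑ (p ∘ suc))))

count-cong : ∀ {N} {p q : Fin N → Bool} → (∀ i → p i ≡ q i) → count p ≡ count q
count-cong {p = p} {q} p≗q = trans (count≡∑ p) (trans (sum-cong-≗ (cong indicator ∘ p≗q)) (sym (count≡∑ q)))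

guarded-count : ∀ {N} b (p : Fin N → Bool) →
  (if b then count p else 0) ≡ ∑[ j < N ] indicator (b ∧ p j)
guarded-count true p = count≡∑ p
guarded-count {N} false p = sym (sum-replicate-zero N)

∑-mono-≤ : ∀ {N} {f g : Fin N → ℕ} → (∀ i → f i ≤ g i) → ∑[ i < N ] f i ≤ ∑[ i < N ] g i
∑-mono-≤ {zero} f≤g = z≤n
∑-mono-≤ {suc N} f≤g = +-mono-≤ (f≤g zero) (∑-mono-≤ (f≤g ∘ suc))

∑-mono-< : ∀ {N} {f g : Fin N → ℕ} → (∀ i → f i ≤ g i) → ∀ i₀ → f i₀ < g i₀ →
  ∑[ i < N ] f i < ∑[ i < N ] g i
∑-mono-< f≤g zero f<g = +-mono-<-≤ f<g (∑-mono-≤ (f≤g ∘ suc))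
∑-mono-< f≤g (suc i₀) f<g = +-mono-≤-< (f≤g zero) (∑-mono-< (f≤g ∘ suc) i₀ f<g)

∑-guarded-const : ∀ {N} k (S : Fin N → Bool) → ∑[ i < N ] (if S i then k else 0) ≡ k * count S
∑-guarded-const {N} k S = begin
  ∑[ i < N ] (if S i then k else 0)    ≡⟨ sum-cong-≗ (λ i → guarded-const (S i)) ⟩
  ∑[ i < N ] (k * indicator (S i))     ≡⟨ sym (*-distribˡ-sum k (indicator ∘ S)) ⟩
  k * (∑[ i < N ] indicator (S i))     ≡⟨ cong (k *_) (sym (count≡∑ S)) ⟩
  k * count S                          ∎
  where
  open ≡-Reasoning
  guarded-const : ∀ b → (if b then k else 0) ≡ k * indicator b
  guarded-const true = sym (*-identityʳ k)
  guarded-const false = sym (*-zeroʳ k)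

count-≤-injection : ∀ {N m} {P : Fin N → Set} (P? : Decidable P) (f : ∀ {x} → P x → Fin m) →
  (∀ {x y} (px : P x) (py : P y) → f px ≡ f py → x ≡ y) → count (does ∘ P?) ≤ m
count-≤-injection {zero} P? f f-inj = z≤n
count-≤-injection {suc N} {m} {P} P? f f-inj rewrite count-suc (does ∘ P?) with P? zero
... | no _ = count-≤-injection (P? ∘ suc) f (λ px py → suc-injective ∘ f-inj px py)
... | yes p₀ = peel m f f-inj
  where
  peel : ∀ m (f : ∀ {x} → P x → Fin m) → (∀ {x y} (px : P x) (py : P y) → f px ≡ f py → x ≡ y) →
    suc (count (does ∘ P? ∘ suc)) ≤ m
  peel zero f _ = ⊥-elim (¬Fin0 (f p₀))
  peel (suc m) f f-inj = s≤s (count-≤-injection (P? ∘ suc)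
    (λ px → punchOut {i = f p₀} (λ e → 0≢1+n (f-inj p₀ px e)))
    (λ px py → suc-injective ∘ f-inj px py ∘ punchOut-injective {i = f p₀} _ _))

count-≥-injection : ∀ {N m} {P : Fin N → Set} (P? : Decidable P) (g : Fin m → Fin N) →
  (∀ {i j} → g i ≡ g j → i ≡ j) → (∀ i → P (g i)) → m ≤ count (does ∘ P?)
count-≥-injection {zero} {zero} P? g g-inj Pg = z≤n
count-≥-injection {zero} {suc m} P? g g-inj Pg = ⊥-elim (¬Fin0 (g zero))
count-≥-injection {suc N} {m} {P} P? g g-inj Pg rewrite count-suc (does ∘ P?) with any? (λ i → g i ≟ zero)
... | no g≢0 = ≤-trans
  (count-≥-injection (P? ∘ suc) (λ i → punchOut {i = zero} {j = g i} (λ e → g≢0 (i , sym e)))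
    (λ e → g-inj (punchOut-injective {i = zero} _ _ e))
    (λ i → subst P (sym (punchIn-punchOut {i = zero} _)) (Pg i)))
  (m≤n+m _ _)
... | yes (i₀ , gi₀≡0) with P? zero
...   | no ¬P0 = ⊥-elim (¬P0 (subst P gi₀≡0 (Pg i₀)))
...   | yes _ = peel g g-inj Pg i₀ gi₀≡0
  where
  peel : ∀ {m} (g : Fin m → Fin (suc N)) → (∀ {i j} → g i ≡ g j → i ≡ j) → (∀ i → P (g i)) →
    (i₀ : Fin m) → g i₀ ≡ zero → m ≤ suc (count (does ∘ P? ∘ suc))
  peel {suc m} g g-inj Pg i₀ gi₀≡0 = s≤s (count-≥-injection (P? ∘ suc)
    (λ i → punchOut {i = zero} {j = g (punchIn i₀ i)} (λ e → punchInᵢ≢i i₀ i (g-inj (trans (sym e) (sym gi₀≡0)))))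
    (λ e → punchIn-injective i₀ _ _ (g-inj (punchOut-injective {i = zero} _ _ e)))
    (λ i → subst P (sym (punchIn-punchOut {i = zero} _)) (Pg (punchIn i₀ i))))

count-witness : ∀ {N} {P : Fin N → Set} (P? : Decidable P) → 0 < count (does ∘ P?) → ∃ P
count-witness {P = P} P? 0<count with any? P?
... | yes witness = witness
... | no ∄P = ⊥-elim (<⇒≱ 0<count (count-≤-injection P? absurd (λ px → absurd px)))
  where
  absurd : ∀ {A : Set} {x} → P x → A
  absurd px = ⊥-elim (∄P (_ , px))

max-≤ : ∀ {N D} (f : Fin N → ℕ) → (∀ i → f i ≤ D) → Vector.foldr _⊔_ 0 f ≤ D
max-≤ {zero} f f≤D = z≤n
max-≤ {suc N} f f≤D = ⊔-lub (f≤D zero) (max-≤ (f ∘ suc) (f≤D ∘ suc))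

≤-max : ∀ {N} (f : Fin N → ℕ) i → f i ≤ Vector.foldr _⊔_ 0 f
≤-max f zero = m≤m⊔n _ _
≤-max f (suc i) = ≤-trans (≤-max (f ∘ suc) i) (m≤n⊔m (f zero) _)

-- Maximum degree, maximum average degree and colourings of G²

Δ≡-attained : ∀ (G : Graph) {D} → (∀ x → deg G x ≤ D) → ∀ x₀ → D ≤ deg G x₀ → Δ G ≡ D
Δ≡-attained G deg≤D x₀ D≤deg = trans (foldr-map-allFin _⊔_ 0 (deg G))
  (≤-antisym (max-≤ (deg G) deg≤D) (≤-trans D≤deg (≤-max (deg G) x₀)))

inDegree : ∀ {N} (O : Fin N → Fin N → Bool) (S : Fin N → Bool) → Fin N → ℕ
inDegree O S i = count (λ j → S j ∧ O j i)

twiceEdges≤2*∑inDegree : ∀ (G : Graph) (O : Fin (N G) → Fin (N G) → Bool) →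
  (∀ i j → T (adj G i j) → T (O i j ∨ O j i)) → ∀ S →
  twiceEdges G S ≤ 2 * ∑[ i < N G ] (if S i then inDegree O S i else 0)
twiceEdges≤2*∑inDegree G O orients S = begin
  twiceEdges G S
    ≡⟨ trans (sum-map-allFin {n} _) (sum-cong-≗ (λ i → guarded-count (S i) (λ j → S j ∧ adj G i j))) ⟩
  ∑[ i < n ] ∑[ j < n ] indicator (S i ∧ (S j ∧ adj G i j))
    ≤⟨ ∑-mono-≤ (λ i → ∑-mono-≤ (λ j → split (S i) (S j) (orients i j))) ⟩
  ∑[ i < n ] ∑[ j < n ] (into i j + into j i)
    ≡⟨ trans (sum-cong-≗ (λ i → ∑-distrib-+ (into i) (λ j → into j i)))
             (∑-distrib-+ (λ i → ∑[ j < n ] into i j) (λ i → ∑[ j < n ] into j i)) ⟩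
  Y + ∑[ i < n ] ∑[ j < n ] into j i
    ≡⟨ cong (Y +_) (∑-comm (λ i j → into j i)) ⟩
  Y + Y
    ≡⟨ cong (Y +_) (sym (+-identityʳ Y)) ⟩
  2 * Y
    ≡⟨ cong (2 *_) (sum-cong-≗ (λ i → sym (guarded-count (S i) (λ j → S j ∧ O j i)))) ⟩
  2 * ∑[ i < n ] (if S i then inDegree O S i else 0) ∎
  where
  open ≤-Reasoning
  n = N G
  into : Fin n → Fin n → ℕ
  into i j = indicator (S i ∧ (S j ∧ O j i))
  Y = ∑[ i < n ] ∑[ j < n ] into i j
  split : ∀ {i j} a b → (T (adj G i j) → T (O i j ∨ O j i)) →
    indicator (a ∧ (b ∧ adj G i j)) ≤ indicator (a ∧ (b ∧ O j i)) + indicator (b ∧ (a ∧ O i j))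
  split {i} {j} false b _ = z≤n
  split {i} {j} true false _ = z≤n
  split {i} {j} true true h with adj G i j | O i j | O j i
  ... | false | _ | _ = z≤n
  ... | true | _ | true = s≤s z≤n
  ... | true | true | false = s≤s z≤n
  ... | true | false | false = ⊥-elim (h tt)

madLessThan-from-orientation : ∀ (G : Graph) k (O : Fin (N G) → Fin (N G) → Bool) →
  (∀ i j → T (adj G i j) → T (O i j ∨ O j i)) →
  (∀ S i → inDegree O S i ≤ k) →
  (∀ S i → T (S i) → ∃ λ j → T (S j) × inDegree O S j < k) →
  madLessThan G (2 * k)
madLessThan-from-orientation G k O orients inDegree≤k deficient S 0<|S| = begin-strict
  twiceEdges G S                                       ≤⟨ twiceEdges≤2*∑inDegree G O orients S ⟩
  2 * ∑[ i < N G ] (if S i then inDegree O S i else 0) <⟨ *-monoʳ-< 2 ∑inDegree<k|S| ⟩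
  2 * (k * count S)                                    ≡⟨ *-assoc 2 k (count S) ⟨
  2 * k * count S                                      ∎
  where
  open ≤-Reasoning
  guarded-≤ : ∀ b {x y} → x ≤ y → (if b then x else 0) ≤ (if b then y else 0)
  guarded-≤ true x≤y = x≤y
  guarded-≤ false _ = z≤n
  guarded-< : ∀ b {x y} → T b → x < y → (if b then x else 0) < (if b then y else 0)
  guarded-< true _ x<y = x<y
  ∑inDegree<k|S| : ∑[ i < N G ] (if S i then inDegree O S i else 0) < k * count S
  ∑inDegree<k|S| with count-witness (T? ∘ S) 0<|S|
  ... | i , Si with deficient S i Si
  ...   | j , Sj , inDegree<k = subst (_ <_) (∑-guarded-const k S)
          (∑-mono-< (λ i → guarded-≤ (S i) (inDegree≤k S i)) j (guarded-< (S j) Sj inDegree<k))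

clique⇒χ²≥ : ∀ (G : Graph) m → HasSquareClique G m → χ²≥ G m
clique⇒χ²≥ G m (f , clique) c col proper = injective⇒≤ col∘f-injective
  where
  col∘f-injective : ∀ {a b} → col (f a) ≡ col (f b) → a ≡ b
  col∘f-injective {a} {b} same with a ≟ b
  ... | yes a≡b = a≡b
  ... | no a≢b = ⊥-elim (proper (f a) (f b) (clique a b a≢b) same)

-- Graphs on an enumerated vertex type

module _ {A B : Set} (e : A ↔ B) where
  open Inverse e

  ↔-to-injective : ∀ {x y} → to x ≡ to y → x ≡ y
  ↔-to-injective {x} {y} eq = trans (sym (strictlyInverseʳ x)) (trans (cong from eq) (strictlyInverseʳ y))

  ↔-from-injective : ∀ {x y} → from x ≡ from y → x ≡ y
  ↔-from-injective {x} {y} eq = trans (sym (strictlyInverseˡ x)) (trans (cong to eq) (strictlyInverseˡ y))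

+↔⊎₃ : ∀ {a b c} → Fin (a + (b + c)) ↔ (Fin a ⊎ (Fin b ⊎ Fin c))
+↔⊎₃ = ↔-trans +↔⊎ (↔-refl ⊎-↔ +↔⊎)

module OrientedGraph {V : Set} {n : ℕ} (enum : V ↔ Fin n)
  (Arc : V → V → Set) (Arc? : ∀ u v → Dec (Arc u v)) (Arc-irrefl : ∀ {v} → ¬ Arc v v) where

  open Inverse enum public using (to; from)
  open Inverse enum using (strictlyInverseˡ; strictlyInverseʳ)

  Adjacent : V → V → Set
  Adjacent u v = Arc u v ⊎ Arc v u

  Adjacent? : ∀ u v → Dec (Adjacent u v)
  Adjacent? u v = Arc? u v ⊎-dec Arc? v u

  Adjacent-sym : ∀ {u v} → Adjacent u v → Adjacent v u
  Adjacent-sym (inj₁ a) = inj₂ a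
  Adjacent-sym (inj₂ a) = inj₁ a

  WithinTwo : V → V → Set
  WithinTwo u v = Adjacent u v ⊎ ∃ λ w → Adjacent u w × Adjacent w v

  WithinTwo-sym : ∀ {u v} → WithinTwo u v → WithinTwo v u
  WithinTwo-sym (inj₁ a) = inj₁ (Adjacent-sym a)
  WithinTwo-sym (inj₂ (w , a , a′)) = inj₂ (w , Adjacent-sym a′ , Adjacent-sym a)

  graph : Graph
  graph = record
    { N = n
    ; adj = λ x y → does (Adjacent? (from x) (from y))
    ; sym = λ x y → ∨-comm (does (Arc? (from x) (from y))) _
    ; irrefl = λ x → cong (λ b → b ∨ b) (dec-false (Arc? (from x) (from x)) Arc-irrefl)
    }

  degree : V → ℕ
  degree v = count (does ∘ Adjacent? v ∘ from)

  arcs : Fin n → Fin n → Bool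
  arcs x y = does (Arc? (from x) (from y))

  count-≤ : ∀ {m} {P : V → Set} (P? : ∀ v → Dec (P v)) (code : ∀ {v} → P v → ℕ) →
    (∀ {v} (pv : P v) → code pv < m) →
    (∀ {u v} (pu : P u) (pv : P v) → code pu ≡ code pv → u ≡ v) → count (does ∘ P? ∘ from) ≤ m
  count-≤ P? code code<m code-inj = count-≤-injection (P? ∘ from) (λ pv → fromℕ< (code<m pv))
    (λ pu pv → ↔-from-injective enum ∘ code-inj pu pv ∘ fromℕ<-injective _ _ (code<m pu) (code<m pv))

  count-≥ : ∀ {m} {P : V → Set} (P? : ∀ v → Dec (P v)) (g : Fin m → V) →
    (∀ {i j} → g i ≡ g j → i ≡ j) → (∀ i → P (g i)) → m ≤ count (does ∘ P? ∘ from)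
  count-≥ {P = P} P? g g-inj Pg = count-≥-injection (P? ∘ from) (to ∘ g)
    (g-inj ∘ ↔-to-injective enum)
    (λ i → subst P (sym (strictlyInverseʳ (g i))) (Pg i))

  InNeighbour : (Fin n → Bool) → V → V → Set
  InNeighbour S w v = T (S (to v)) × Arc v w

  InNeighbour? : ∀ S w v → Dec (InNeighbour S w v)
  InNeighbour? S w v = T? (S (to v)) ×-dec Arc? v w

  inDegreeIn : (Fin n → Bool) → V → ℕ
  inDegreeIn S w = count (does ∘ InNeighbour? S w ∘ from)

  inDegree≡inDegreeIn : ∀ S x → inDegree arcs S x ≡ inDegreeIn S (from x)
  inDegree≡inDegreeIn S x = count-cong (λ y → cong (λ y′ → S y′ ∧ arcs y x) (sym (strictlyInverseˡ y)))

  madLessThan-graph : ∀ k → (∀ S w → inDegreeIn S w ≤ k) →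
    (∀ S v → T (S (to v)) → ∃ λ w → T (S (to w)) × inDegreeIn S w < k) → madLessThan graph (2 * k)
  madLessThan-graph k inDegree≤k deficient = madLessThan-from-orientation graph k arcs (λ _ _ → id)
    (λ S x → subst (_≤ k) (sym (inDegree≡inDegreeIn S x)) (inDegree≤k S (from x)))
    (λ S x Sx → lift S (deficient S (from x) (subst (T ∘ S) (sym (strictlyInverseˡ x)) Sx)))
    where
    lift : ∀ S → (∃ λ w → T (S (to w)) × inDegreeIn S w < k) → ∃ λ y → T (S y) × inDegree arcs S y < k
    lift S (w , Sw , <k) = to w , Sw ,
      subst (_< k) (sym (trans (inDegree≡inDegreeIn S (to w)) (cong (inDegreeIn S) (strictlyInverseʳ w)))) <k

  adj-to : ∀ {u v} → Adjacent u v → adj graph (to u) (to v) ≡ true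
  adj-to {u} {v} a = dec-true (Adjacent? _ _) (subst₂ Adjacent (sym (strictlyInverseʳ u)) (sym (strictlyInverseʳ v)) a)

  squareClique : ∀ {m} (f : Fin m → V) → (∀ {a b} → f a ≡ f b → a ≡ b) →
    (∀ a b → a ≢ b → WithinTwo (f a) (f b)) → HasSquareClique graph m
  squareClique f f-inj within = to ∘ f , λ a b a≢b → (a≢b ∘ f-inj ∘ ↔-to-injective enum) , lift (within a b a≢b)
    where
    lift : ∀ {u v} → WithinTwo u v →
      adj graph (to u) (to v) ≡ true ⊎ ∃ λ x → adj graph (to u) x ≡ true × adj graph x (to v) ≡ true
    lift (inj₁ a) = inj₁ (adj-to a)
    lift (inj₂ (w , a , a′)) = inj₂ (to w , adj-to a , adj-to a′)

-- Lines over ℤ/n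

module AffineLines (n : ℕ) .{{_ : NonZero n}} where

  infix 4 _≋_
  record _≋_ (a b : ℕ) : Set where
    constructor mod-≡
    field %-≡ : a % n ≡ b % n
  open _≋_

  ≋-isEquivalence : IsEquivalence _≋_
  ≋-isEquivalence = record
    { refl = mod-≡ refl
    ; sym = λ (mod-≡ e) → mod-≡ (sym e)
    ; trans = λ (mod-≡ e) (mod-≡ f) → mod-≡ (trans e f)
    }

  ≋-setoid : Setoid _ _
  ≋-setoid = record { isEquivalence = ≋-isEquivalence }

  module Reasoning = SetoidReasoning ≋-setoid

  open IsEquivalence ≋-isEquivalence public using () renaming (refl to ≋-refl; sym to ≋-sym; trans to ≋-trans)

  ≡⇒≋ : ∀ {a b} → a ≡ b → a ≋ b
  ≡⇒≋ e = mod-≡ (cong (_% n) e)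

  +-cong : ∀ {a a′ b b′} → a ≋ a′ → b ≋ b′ → a + b ≋ a′ + b′
  +-cong {a} {a′} {b} {b′} (mod-≡ e) (mod-≡ f) = mod-≡ (begin
    (a + b) % n               ≡⟨ %-distribˡ-+ a b n ⟩
    (a % n + b % n) % n       ≡⟨ cong₂ (λ x y → (x + y) % n) e f ⟩
    (a′ % n + b′ % n) % n     ≡⟨ %-distribˡ-+ a′ b′ n ⟨
    (a′ + b′) % n             ∎)
    where open ≡-Reasoning

  *-cong : ∀ {a a′ b b′} → a ≋ a′ → b ≋ b′ → a * b ≋ a′ * b′
  *-cong {a} {a′} {b} {b′} (mod-≡ e) (mod-≡ f) = mod-≡ (begin
    (a * b) % n               ≡⟨ %-distribˡ-* a b n ⟩
    (a % n * (b % n)) % n     ≡⟨ cong₂ (λ x y → (x * y) % n) e f ⟩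
    (a′ % n * (b′ % n)) % n   ≡⟨ %-distribˡ-* a′ b′ n ⟨
    (a′ * b′) % n             ∎)
    where open ≡-Reasoning

  %-≋ : ∀ a → a % n ≋ a
  %-≋ a = mod-≡ (m%n%n≡m%n a n)

  +-multiple-≋ : ∀ a k → a + k * n ≋ a
  +-multiple-≋ a k = mod-≡ ([m+kn]%n≡m%n a k n)

  ≋⇒≡ : ∀ {a b} → a < n → b < n → a ≋ b → a ≡ b
  ≋⇒≡ a<n b<n (mod-≡ e) = trans (sym (m<n⇒m%n≡m a<n)) (trans e (m<n⇒m%n≡m b<n))

  neg : ℕ → ℕ
  neg x = n ∸ x % n

  +-neg : ∀ x → x + neg x ≋ 0
  +-neg x = begin
    x + (n ∸ x % n)          ≈⟨ +-cong (%-≋ x) ≋-refl ⟨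
    x % n + (n ∸ x % n)      ≡⟨ m+[n∸m]≡n (m%n≤n x n) ⟩
    n                        ≡⟨ *-identityˡ n ⟨
    0 + 1 * n                ≈⟨ +-multiple-≋ 0 1 ⟩
    0                        ∎
    where open Reasoning

  +-cancelʳ : ∀ {a b} x → a + x ≋ b + x → a ≋ b
  +-cancelʳ {a} {b} x a+x≋b+x = begin
    a                        ≡⟨ +-identityʳ a ⟨
    a + 0                    ≈⟨ +-cong ≋-refl (+-neg x) ⟨
    a + (x + neg x)          ≡⟨ +-assoc a x (neg x) ⟨
    a + x + neg x            ≈⟨ +-cong a+x≋b+x ≋-refl ⟩
    b + x + neg x            ≡⟨ +-assoc b x (neg x) ⟩
    b + (x + neg x)          ≈⟨ +-cong ≋-refl (+-neg x) ⟩
    b + 0                    ≡⟨ +-identityʳ b ⟩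
    b                        ∎
    where open Reasoning

  multiple-≋ : ∀ k → k * n ≋ 0
  multiple-≋ k = +-multiple-≋ 0 k

  inverse : Prime n → ∀ d → 0 < d → d < n → ∃ λ y → d * y ≋ 1
  inverse n-prime d@(suc _) _ d<n with coprime-Bézout (prime⇒coprime n-prime d<n)
  ... | Bézout.-+ x y eq = y , (begin
    d * y                    ≡⟨ *-comm d y ⟩
    y * d                    ≡⟨ eq ⟨
    1 + x * n                ≈⟨ +-multiple-≋ 1 x ⟩
    1                        ∎)
    where open Reasoning
  ... | Bézout.+- x y eq = neg y , +-cancelʳ (d * y) (begin
    d * neg y + d * y        ≡⟨ *-distribˡ-+ d (neg y) y ⟨
    d * (neg y + y)          ≈⟨ *-cong {d} ≋-refl (≋-trans (≡⇒≋ (+-comm (neg y) y)) (+-neg y)) ⟩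
    d * 0                    ≡⟨ *-zeroʳ d ⟩
    0                        ≈⟨ multiple-≋ x ⟨
    x * n                    ≡⟨ eq ⟨
    1 + y * d                ≡⟨ cong (1 +_) (*-comm y d) ⟩
    1 + d * y                ∎)
    where open Reasoning

  record OnLine (s t : Fin n) (x : ℕ) (a : Fin n) : Set where
    constructor on-line
    field equation : toℕ s + toℕ t * x ≋ toℕ a
  open OnLine

  OnLine? : ∀ s t x a → Dec (OnLine s t x a)
  OnLine? s t x a = map′ (on-line ∘ mod-≡) (%-≡ ∘ equation) ((toℕ s + toℕ t * x) % n ℕ.≟ toℕ a % n)

  mod-≋ : ∀ m → toℕ (m mod n) ≋ m
  mod-≋ m = ≋-trans (≡⇒≋ (toℕ-fromℕ< (m%n<n m n))) (%-≋ m)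

  value-unique : ∀ {s t x a a′} → OnLine s t x a → OnLine s t x a′ → a ≡ a′
  value-unique {a = a} {a′} (on-line e) (on-line e′) =
    toℕ-injective (≋⇒≡ (toℕ<n a) (toℕ<n a′) (≋-trans (≋-sym e) e′))

  intercept-unique : ∀ {s s′ t x a} → OnLine s t x a → OnLine s′ t x a → s ≡ s′
  intercept-unique {s} {s′} {t} {x} (on-line e) (on-line e′) =
    toℕ-injective (≋⇒≡ (toℕ<n s) (toℕ<n s′) (+-cancelʳ (toℕ t * x) (≋-trans e (≋-sym e′))))

  value-exists : ∀ s t x → ∃ λ a → OnLine s t x a
  value-exists s t x = _ mod n , on-line (≋-sym (mod-≋ _))

  intercept-exists : ∀ t x a → ∃ λ s → OnLine s t x a
  intercept-exists t x a = (toℕ a + neg tx) mod n , on-line (begin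
    toℕ ((toℕ a + neg tx) mod n) + tx   ≈⟨ +-cong (mod-≋ _) ≋-refl ⟩
    toℕ a + neg tx + tx                     ≡⟨ +-assoc (toℕ a) (neg tx) tx ⟩
    toℕ a + (neg tx + tx)                   ≈⟨ +-cong ≋-refl (≋-trans (≡⇒≋ (+-comm (neg tx) tx)) (+-neg tx)) ⟩
    toℕ a + 0                               ≡⟨ +-identityʳ (toℕ a) ⟩
    toℕ a                                   ∎)
    where
    open Reasoning
    tx = toℕ t * x

  OnLine-column₀ : ∀ {s t a} → OnLine s t 0 a → s ≡ a
  OnLine-column₀ {s} {t} {a} (on-line e) = toℕ-injective (≋⇒≡ (toℕ<n s) (toℕ<n a)
    (≋-trans (≡⇒≋ (sym (trans (cong (toℕ s +_) (*-zeroʳ (toℕ t))) (+-identityʳ (toℕ s))))) e))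

  intercept-on-column₀ : ∀ s t → OnLine s t 0 s
  intercept-on-column₀ s t = on-line (≡⇒≋ (trans (cong (toℕ s +_) (*-zeroʳ (toℕ t))) (+-identityʳ (toℕ s))))

  slope-through : Prime n → ∀ d → 0 < d → d < n → ∀ c → ∃ λ t → toℕ t * d ≋ c
  slope-through n-prime d 0<d d<n c with inverse n-prime d 0<d d<n
  ... | y , dy≋1 = (c * y) mod n , (begin
    toℕ ((c * y) mod n) * d  ≈⟨ *-cong (mod-≋ (c * y)) ≋-refl ⟩
    c * y * d                    ≡⟨ *-assoc c y d ⟩
    c * (y * d)                  ≡⟨ cong (c *_) (*-comm y d) ⟩
    c * (d * y)                  ≈⟨ *-cong {c} ≋-refl dy≋1 ⟩
    c * 1                        ≡⟨ *-identityʳ c ⟩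
    c                            ∎)
    where open Reasoning

  line-through : Prime n → ∀ x d → 0 < d → d < n → ∀ a b → ∃₂ λ s t → OnLine s t x a × OnLine s t (x + d) b
  line-through n-prime x d 0<d d<n a b with slope-through n-prime d 0<d d<n (toℕ b + neg (toℕ a))
  ... | t , td≋b-a with intercept-exists t x a
  ... | s , on-a = s , t , on-a , on-line (begin
    toℕ s + toℕ t * (x + d)           ≡⟨ distrib (toℕ s) (toℕ t) x d ⟩
    toℕ s + toℕ t * x + toℕ t * d     ≈⟨ +-cong (equation on-a) td≋b-a ⟩
    toℕ a + (toℕ b + neg (toℕ a))     ≡⟨ swap (toℕ a) (toℕ b) (neg (toℕ a)) ⟩
    toℕ b + (toℕ a + neg (toℕ a))     ≈⟨ +-cong ≋-refl (+-neg (toℕ a)) ⟩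
    toℕ b + 0                         ≡⟨ +-identityʳ (toℕ b) ⟩
    toℕ b                             ∎)
    where
    open Reasoning
    distrib : ∀ s t x d → s + t * (x + d) ≡ s + t * x + t * d
    distrib = solve-∀
    swap : ∀ a b c → a + (b + c) ≡ b + (a + c)
    swap = solve-∀

-- The construction

module Construction (k-2 m₀ : ℕ) where

  k-1 k F n n-1 : ℕ
  k-1 = suc k-2
  k = suc k-1
  F = k * k-1
  n = F + m₀
  n-1 = pred n

  open AffineLines n

  -- shallow c j is the slope c(k−1) + j, of class c; steep r is the slope k(k−1) + r.
  data Slope : Set where
    shallow : Fin k → Fin k-1 → Slope
    steep : Fin m₀ → Slope

  slope↔ : Slope ↔ Fin n
  slope↔ = ↔-trans slope↔⊎ (↔-trans (↔-sym *↔× ⊎-↔ ↔-refl) (↔-sym +↔⊎))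
    where
    slope↔⊎ : Slope ↔ ((Fin k × Fin k-1) ⊎ Fin m₀)
    slope↔⊎ = mk↔ₛ′ (λ { (shallow c j) → inj₁ (c , j) ; (steep r) → inj₂ r })
      (λ { (inj₁ (c , j)) → shallow c j ; (inj₂ r) → steep r })
      (λ { (inj₁ _) → refl ; (inj₂ _) → refl })
      (λ { (shallow _ _) → refl ; (steep _) → refl })

  open Inverse slope↔ using () renaming (to to slope; from to fromSlope)

  slope-injective : ∀ {σ τ} → slope σ ≡ slope τ → σ ≡ τ
  slope-injective = ↔-to-injective slope↔

  Incident : Fin n → Slope → Fin k → Fin n → Set
  Incident s σ i a = OnLine s (slope σ) (toℕ i) a

  Incident? : ∀ s σ i a → Dec (Incident s σ i a)
  Incident? s σ i a = OnLine? s (slope σ) (toℕ i) a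

  data Vertex : Set where
    point : Fin k → Fin n → Vertex
    column : Fin k → Vertex
    line : Fin n → Slope → Vertex

  data Owns (i : Fin k) : Fin n → Slope → Set where
    owns : ∀ {s j} → Owns i (suc s) (shallow i j)

  Owns? : ∀ i s σ → Dec (Owns i s σ)
  Owns? i zero σ = no λ ()
  Owns? i (suc s) (steep r) = no λ ()
  Owns? i (suc s) (shallow c j) with i ≟ c
  ... | yes refl = yes owns
  ... | no i≢c = no λ { owns → i≢c refl }

  data Arc : Vertex → Vertex → Set where
    column→point : ∀ {i a} → Arc (column i) (point i a)
    column→column : ∀ {i j} → toℕ i < toℕ j → Arc (column i) (column j)
    point→line : ∀ {i a s σ} → Incident s σ i a → ¬ Owns i s σ → Arc (point i a) (line s σ)
    line→point : ∀ {i a s j} → Incident (suc s) (shallow i j) i a → Arc (line (suc s) (shallow i j)) (point i a)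
    origin→line : ∀ {c j s} → Arc (line zero (shallow c j)) (line (suc s) (shallow c j))

  shallow-≟ : ∀ c j σ → Dec (shallow c j ≡ σ)
  shallow-≟ c j (steep r) = no λ ()
  shallow-≟ c j (shallow c′ j′) with c ≟ c′ | j ≟ j′
  ... | yes refl | yes refl = yes refl
  ... | no c≢c′ | _ = no λ { refl → c≢c′ refl }
  ... | _ | no j≢j′ = no λ { refl → j≢j′ refl }

  Arc? : ∀ u v → Dec (Arc u v)
  Arc? (column i) (point i′ a) with i ≟ i′
  ... | yes refl = yes column→point
  ... | no i≢i′ = no λ { column→point → i≢i′ refl }
  Arc? (column i) (column j) = map′ column→column (λ { (column→column i<j) → i<j }) (toℕ i ℕ.<? toℕ j)
  Arc? (point i a) (line s σ) = map′ (uncurry point→line) (λ { (point→line on ¬owns) → on , ¬owns })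
    (Incident? s σ i a ×-dec ¬? (Owns? i s σ))
  Arc? (line (suc s) (shallow c j)) (point i a) with c ≟ i
  ... | yes refl = map′ line→point (λ { (line→point on) → on }) (Incident? (suc s) (shallow c j) c a)
  ... | no c≢i = no λ { (line→point _) → c≢i refl }
  Arc? (line zero (shallow c j)) (line (suc s) σ) with shallow-≟ c j σ
  ... | yes refl = yes origin→line
  ... | no ≢σ = no λ { origin→line → ≢σ refl }
  Arc? (point _ _) (point _ _) = no λ ()
  Arc? (point _ _) (column _) = no λ ()
  Arc? (column _) (line _ _) = no λ ()
  Arc? (line _ _) (column _) = no λ ()
  Arc? (line zero _) (point _ _) = no λ ()
  Arc? (line (suc _) (steep _)) (point _ _) = no λ ()
  Arc? (line zero (steep _)) (line _ _) = no λ ()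
  Arc? (line zero (shallow _ _)) (line zero _) = no λ ()
  Arc? (line (suc _) _) (line _ _) = no λ ()

  Arc-irrefl : ∀ {v} → ¬ Arc v v
  Arc-irrefl (column→column i<i) = <-irrefl refl i<i

  vertex↔ : Vertex ↔ Fin (k * n + (k + n * n))
  vertex↔ = ↔-trans vertex↔⊎
    (↔-sym (↔-trans +↔⊎₃ (*↔× ⊎-↔ (↔-refl ⊎-↔ ↔-trans *↔× (↔-refl ×-↔ ↔-sym slope↔)))))
    where
    vertex↔⊎ : Vertex ↔ ((Fin k × Fin n) ⊎ (Fin k ⊎ (Fin n × Slope)))
    vertex↔⊎ = mk↔ₛ′
      (λ { (point i a) → inj₁ (i , a) ; (column i) → inj₂ (inj₁ i) ; (line s σ) → inj₂ (inj₂ (s , σ)) })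
      (λ { (inj₁ (i , a)) → point i a ; (inj₂ (inj₁ i)) → column i ; (inj₂ (inj₂ (s , σ))) → line s σ })
      (λ { (inj₁ _) → refl ; (inj₂ (inj₁ _)) → refl ; (inj₂ (inj₂ _)) → refl })
      (λ { (point _ _) → refl ; (column _) → refl ; (line _ _) → refl })

  open OrientedGraph vertex↔ Arc Arc? Arc-irrefl public

  D : ℕ
  D = n + k-1

  points-nonadjacent : ∀ {i a i′ a′} → ¬ Adjacent (point i a) (point i′ a′)
  points-nonadjacent (inj₁ ())
  points-nonadjacent (inj₂ ())

  point-line-incidence : ∀ {i a s σ} → Adjacent (point i a) (line s σ) → Incident s σ i a
  point-line-incidence (inj₁ (point→line on _)) = on
  point-line-incidence (inj₂ (line→point on)) = on

  line-point-incidence : ∀ {i a s σ} → Adjacent (line s σ) (point i a) → Incident s σ i a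
  line-point-incidence (inj₁ (line→point on)) = on
  line-point-incidence (inj₂ (point→line on _)) = on

  degree-point : ∀ i a → degree (point i a) ≤ D
  degree-point i a = count-≤ (Adjacent? (point i a)) code code<D code-injective
    where
    code : ∀ {v} → Adjacent (point i a) v → ℕ
    code {line _ σ} _ = toℕ (slope σ)
    code {column _} _ = n
    code {point _ _} adj = ⊥-elim (points-nonadjacent adj)
    code<D : ∀ {v} (adj : Adjacent (point i a) v) → code adj < D
    code<D {line _ σ} _ = ≤-trans (toℕ<n (slope σ)) (m≤m+n n k-1)
    code<D {column _} _ = m<m+n n (s≤s z≤n)
    code<D {point _ _} adj = ⊥-elim (points-nonadjacent adj)
    code-injective : ∀ {u v} (pu : Adjacent (point i a) u) (pv : Adjacent (point i a) v) → code pu ≡ code pv → u ≡ v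
    code-injective {line s σ} {line s′ σ′} pu pv same-slope with slope-injective {σ} {σ′} (toℕ-injective same-slope)
    ... | refl = cong (λ s → line s σ) (intercept-unique (point-line-incidence pu) (point-line-incidence pv))
    code-injective {line s σ} {column _} _ _ e = ⊥-elim (<-irrefl e (toℕ<n (slope σ)))
    code-injective {column _} {line s σ} _ _ e = ⊥-elim (<-irrefl (sym e) (toℕ<n (slope σ)))
    code-injective {column _} {column _} (inj₂ column→point) (inj₂ column→point) _ = refl
    code-injective {point _ _} pu _ _ = ⊥-elim (points-nonadjacent pu)
    code-injective {_} {point _ _} _ pv _ = ⊥-elim (points-nonadjacent pv)

  columns-distinct : ∀ {i j} → Adjacent (column i) (column j) → i ≢ j
  columns-distinct (inj₁ (column→column i<j)) refl = <-irrefl refl i<j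
  columns-distinct (inj₂ (column→column j<i)) refl = <-irrefl refl j<i

  column-line-nonadjacent : ∀ {i s σ} → ¬ Adjacent (column i) (line s σ)
  column-line-nonadjacent (inj₁ ())
  column-line-nonadjacent (inj₂ ())

  degree-column : ∀ i → degree (column i) ≤ D
  degree-column i = count-≤ (Adjacent? (column i)) code code<D code-injective
    where
    code : ∀ {v} → Adjacent (column i) v → ℕ
    code {point _ a} _ = toℕ a
    code {column _} adj = n + toℕ (punchOut (columns-distinct adj))
    code {line _ _} adj = ⊥-elim (column-line-nonadjacent adj)
    code<D : ∀ {v} (adj : Adjacent (column i) v) → code adj < D
    code<D {point _ a} _ = ≤-trans (toℕ<n a) (m≤m+n n k-1)
    code<D {column _} adj = +-monoʳ-< n (toℕ<n (punchOut (columns-distinct adj)))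
    code<D {line _ _} adj = ⊥-elim (column-line-nonadjacent adj)
    code-injective : ∀ {u v} (pu : Adjacent (column i) u) (pv : Adjacent (column i) v) → code pu ≡ code pv → u ≡ v
    code-injective {point _ _} {point _ _} (inj₁ column→point) (inj₁ column→point) e = cong (point i) (toℕ-injective e)
    code-injective {column _} {column _} pu pv e =
      cong column (punchOut-injective (columns-distinct pu) (columns-distinct pv) (toℕ-injective (+-cancelˡ-≡ n _ _ e)))
    code-injective {point _ a} {column _} _ _ e = ⊥-elim (<⇒≢ (<-≤-trans (toℕ<n a) (m≤m+n n _)) e)
    code-injective {column _} {point _ a} _ _ e = ⊥-elim (<⇒≢ (<-≤-trans (toℕ<n a) (m≤m+n n _)) (sym e))
    code-injective {line _ _} pu _ _ = ⊥-elim (column-line-nonadjacent pu)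
    code-injective {_} {line _ _} _ pv _ = ⊥-elim (column-line-nonadjacent pv)

  k≤n : k ≤ n
  k≤n = ≤-trans (m≤m*n k k-1) (m≤m+n F m₀)

  k<D : k < D
  k<D = ≤-trans (≤-reflexive (+-comm 1 k)) (+-mono-≤ k≤n (s≤s z≤n))

  k+n-1≡D : k + n-1 ≡ D
  k+n-1≡D = cong suc (+-comm k-1 n-1)

  degree-line : ∀ s σ → degree (line s σ) ≤ D
  degree-line s σ = count-≤ (Adjacent? (line s σ)) code code<D code-injective
    where
    code : ∀ {v} → Adjacent (line s σ) v → ℕ
    code {point i _} _ = toℕ i
    code {line _ _} (inj₁ (origin→line {s = t})) = k + toℕ t
    code {line _ _} (inj₂ origin→line) = k
    code {column _} adj = ⊥-elim (column-line-nonadjacent (Adjacent-sym adj))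
    code<D : ∀ {v} (adj : Adjacent (line s σ) v) → code adj < D
    code<D {point i _} _ = <-trans (toℕ<n i) k<D
    code<D {line _ _} (inj₁ (origin→line {s = t})) = <-≤-trans (+-monoʳ-< k (toℕ<n t)) (≤-reflexive k+n-1≡D)
    code<D {line _ _} (inj₂ origin→line) = k<D
    code<D {column _} adj = ⊥-elim (column-line-nonadjacent (Adjacent-sym adj))
    code-injective : ∀ {u v} (pu : Adjacent (line s σ) u) (pv : Adjacent (line s σ) v) → code pu ≡ code pv → u ≡ v
    code-injective {point i a} {point i′ a′} pu pv e with toℕ-injective {i = i} {i′} e
    ... | refl = cong (point i) (value-unique (line-point-incidence pu) (line-point-incidence pv))
    code-injective (inj₁ origin→line) (inj₁ origin→line) e =
      cong (λ t → line (suc t) σ) (toℕ-injective (+-cancelˡ-≡ k _ _ e))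
    code-injective (inj₂ origin→line) (inj₂ origin→line) _ = refl
    code-injective {point i _} {line _ _} _ (inj₁ origin→line) e = ⊥-elim (<⇒≢ (<-≤-trans (toℕ<n i) (m≤m+n k _)) e)
    code-injective {point i _} {line _ _} _ (inj₂ origin→line) e = ⊥-elim (<-irrefl e (toℕ<n i))
    code-injective {line _ _} {point i _} (inj₁ origin→line) _ e = ⊥-elim (<⇒≢ (<-≤-trans (toℕ<n i) (m≤m+n k _)) (sym e))
    code-injective {line _ _} {point i _} (inj₂ origin→line) _ e = ⊥-elim (<-irrefl (sym e) (toℕ<n i))
    code-injective {column _} pu _ _ = ⊥-elim (column-line-nonadjacent (Adjacent-sym pu))
    code-injective {_} {column _} _ pv _ = ⊥-elim (column-line-nonadjacent (Adjacent-sym pv))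

  degree-column₀ : D ≤ degree (column zero)
  degree-column₀ = count-≥ (Adjacent? (column zero)) neighbour
    (λ e → ↔-to-injective +↔⊎ (neighbour′-injective e)) (adjacent ∘ Fin.splitAt n)
    where
    neighbour′ : Fin n ⊎ Fin k-1 → Vertex
    neighbour′ (inj₁ a) = point zero a
    neighbour′ (inj₂ j) = column (suc j)
    neighbour : Fin D → Vertex
    neighbour = neighbour′ ∘ Fin.splitAt n
    neighbour′-injective : ∀ {x y} → neighbour′ x ≡ neighbour′ y → x ≡ y
    neighbour′-injective {inj₁ _} {inj₁ _} refl = refl
    neighbour′-injective {inj₂ _} {inj₂ _} refl = refl
    adjacent : ∀ x → Adjacent (column zero) (neighbour′ x)
    adjacent (inj₁ a) = inj₁ column→point
    adjacent (inj₂ j) = inj₁ (column→column (s≤s z≤n))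

  module _ (S : Fin (N graph) → Bool) where

    in-point-code : ∀ {i a v} → InNeighbour S (point i a) v → ℕ
    in-point-code (_ , column→point) = k-1
    in-point-code (_ , line→point {j = j} _) = toℕ j

    in-point-code-injective : ∀ {i a u v} (pu : InNeighbour S (point i a) u) (pv : InNeighbour S (point i a) v) →
      in-point-code pu ≡ in-point-code pv → u ≡ v
    in-point-code-injective (_ , column→point) (_ , column→point) _ = refl
    in-point-code-injective {i} (_ , line→point {j = j} on) (_ , line→point {j = j′} on′) e
      with toℕ-injective {i = j} {j′} e
    ... | refl = cong (λ s → line s (shallow i j)) (intercept-unique on on′)
    in-point-code-injective (_ , column→point) (_ , line→point {j = j} _) e = ⊥-elim (<-irrefl (sym e) (toℕ<n j))
    in-point-code-injective (_ , line→point {j = j} _) (_ , column→point) e = ⊥-elim (<-irrefl e (toℕ<n j))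

    inDegree-point : ∀ i a → inDegreeIn S (point i a) ≤ k
    inDegree-point i a = count-≤ (InNeighbour? S (point i a)) in-point-code bound in-point-code-injective
      where
      bound : ∀ {v} (pv : InNeighbour S (point i a) v) → in-point-code pv < k
      bound (_ , column→point) = ≤-refl
      bound (_ , line→point {j = j} _) = m<n⇒m<1+n (toℕ<n j)

    inDegree-point-without-column : ∀ i a → ¬ T (S (to (column i))) → inDegreeIn S (point i a) < k
    inDegree-point-without-column i a column∉S =
      s≤s (count-≤ (InNeighbour? S (point i a)) in-point-code bound in-point-code-injective)
      where
      bound : ∀ {v} (pv : InNeighbour S (point i a) v) → in-point-code pv < k-1
      bound (column∈S , column→point) = ⊥-elim (column∉S column∈S)
      bound (_ , line→point {j = j} _) = toℕ<n j

    inDegree-column : ∀ j → inDegreeIn S (column j) < k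
    inDegree-column j = s≤s (count-≤ (InNeighbour? S (column j)) code bound code-injective)
      where
      code : ∀ {v} → InNeighbour S (column j) v → ℕ
      code (_ , column→column {i} _) = toℕ i
      bound : ∀ {v} (pv : InNeighbour S (column j) v) → code pv < k-1
      bound (_ , column→column i<j) = <-≤-trans i<j (≤-pred (toℕ<n j))
      code-injective : ∀ {u v} (pu : InNeighbour S (column j) u) (pv : InNeighbour S (column j) v) →
        code pu ≡ code pv → u ≡ v
      code-injective (_ , column→column _) (_ , column→column _) e = cong column (toℕ-injective e)

    in-line-code : ∀ {s σ v} → InNeighbour S (line s σ) v → ℕ
    in-line-code (_ , point→line {i} _ _) = toℕ i
    in-line-code (_ , origin→line {c}) = toℕ c

    inDegree-line : ∀ s σ → inDegreeIn S (line s σ) ≤ k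
    inDegree-line s σ = count-≤ (InNeighbour? S (line s σ)) in-line-code bound code-injective
      where
      bound : ∀ {v} (pv : InNeighbour S (line s σ) v) → in-line-code pv < k
      bound (_ , point→line {i} _ _) = toℕ<n i
      bound (_ , origin→line {c}) = toℕ<n c
      code-injective : ∀ {u v} (pu : InNeighbour S (line s σ) u) (pv : InNeighbour S (line s σ) v) →
        in-line-code pu ≡ in-line-code pv → u ≡ v
      code-injective (_ , point→line {i} on _) (_ , point→line {i′} on′ _) e with toℕ-injective {i = i} {i′} e
      ... | refl = cong (point i) (value-unique on on′)
      code-injective (_ , origin→line) (_ , origin→line) _ = refl
      code-injective (_ , point→line {i} _ ¬owns) (_ , origin→line {c}) e with toℕ-injective {i = i} {c} e
      ... | refl = ⊥-elim (¬owns owns)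
      code-injective (_ , origin→line {c}) (_ , point→line {i} _ ¬owns) e with toℕ-injective {i = c} {i} e
      ... | refl = ⊥-elim (¬owns owns)

    inDegree-owned-line-without-origin : ∀ s c j → ¬ T (S (to (line zero (shallow c j)))) →
      inDegreeIn S (line (suc s) (shallow c j)) < k
    inDegree-owned-line-without-origin s c j origin∉S =
      s≤s (count-≤ (InNeighbour? S (line (suc s) (shallow c j))) code bound code-injective)
      where
      owner≢ : ∀ {i} → ¬ Owns i (suc s) (shallow c j) → c ≢ i
      owner≢ ¬owns refl = ¬owns owns
      code : ∀ {v} → InNeighbour S (line (suc s) (shallow c j)) v → ℕ
      code (_ , point→line _ ¬owns) = toℕ (punchOut (owner≢ ¬owns))
      code (origin∈S , origin→line) = ⊥-elim (origin∉S origin∈S)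
      bound : ∀ {v} (pv : InNeighbour S (line (suc s) (shallow c j)) v) → code pv < k-1
      bound (_ , point→line _ ¬owns) = toℕ<n (punchOut (owner≢ ¬owns))
      bound (origin∈S , origin→line) = ⊥-elim (origin∉S origin∈S)
      code-injective : ∀ {u v} (pu : InNeighbour S (line (suc s) (shallow c j)) u)
        (pv : InNeighbour S (line (suc s) (shallow c j)) v) →
        code pu ≡ code pv → u ≡ v
      code-injective (_ , point→line on ¬owns) (_ , point→line on′ ¬owns′) e
        with punchOut-injective (owner≢ ¬owns) (owner≢ ¬owns′) (toℕ-injective e)
      ... | refl = cong (point _) (value-unique on on′)
      code-injective (origin∈S , origin→line) _ _ = ⊥-elim (origin∉S origin∈S)
      code-injective _ (origin∈S , origin→line) _ = ⊥-elim (origin∉S origin∈S)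

    inDegree-unowned-line-without-point₀ : ∀ s σ → (∀ {s′ σ′} → ¬ Arc (line s′ σ′) (line s σ)) →
      ¬ T (S (to (point zero s))) → inDegreeIn S (line s σ) < k
    inDegree-unowned-line-without-point₀ s σ no-line-arc point₀∉S =
      s≤s (count-≤ (InNeighbour? S (line s σ)) code bound code-injective)
      where
      column≢0 : ∀ {i a} → T (S (to (point i a))) → Incident s σ i a → zero ≢ i
      column≢0 point∈S on refl = point₀∉S (subst (λ a → T (S (to (point zero a)))) (sym (OnLine-column₀ on)) point∈S)
      code : ∀ {v} → InNeighbour S (line s σ) v → ℕ
      code (point∈S , point→line on _) = toℕ (punchOut (column≢0 point∈S on))
      code (_ , origin→line) = ⊥-elim (no-line-arc origin→line)
      bound : ∀ {v} (pv : InNeighbour S (line s σ) v) → code pv < k-1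
      bound (point∈S , point→line on _) = toℕ<n (punchOut (column≢0 point∈S on))
      bound (_ , origin→line) = ⊥-elim (no-line-arc origin→line)
      code-injective : ∀ {u v} (pu : InNeighbour S (line s σ) u) (pv : InNeighbour S (line s σ) v) →
        code pu ≡ code pv → u ≡ v
      code-injective (point∈S , point→line on _) (point∈S′ , point→line on′ _) e
        with punchOut-injective (column≢0 point∈S on) (column≢0 point∈S′ on′) (toℕ-injective e)
      ... | refl = cong (point _) (value-unique on on′)
      code-injective (_ , origin→line) _ _ = ⊥-elim (no-line-arc origin→line)
      code-injective _ (_ , origin→line) _ = ⊥-elim (no-line-arc origin→line)

    Deficient : Set
    Deficient = ∃ λ w → T (S (to w)) × inDegreeIn S w < k

    deficient-point : ∀ i a → T (S (to (point i a))) → Deficient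
    deficient-point i a point∈S with T? (S (to (column i)))
    ... | yes column∈S = column i , column∈S , inDegree-column i
    ... | no column∉S = point i a , point∈S , inDegree-point-without-column i a column∉S

    deficient-unowned-line : ∀ s σ → (∀ {s′ σ′} → ¬ Arc (line s′ σ′) (line s σ)) →
      T (S (to (line s σ))) → Deficient
    deficient-unowned-line s σ no-line-arc line∈S with T? (S (to (point zero s)))
    ... | yes point₀∈S = deficient-point zero s point₀∈S
    ... | no point₀∉S = line s σ , line∈S , inDegree-unowned-line-without-point₀ s σ no-line-arc point₀∉S

    deficient : ∀ v → T (S (to v)) → Deficient
    deficient (point i a) = deficient-point i a
    deficient (column j) column∈S = column j , column∈S , inDegree-column j
    deficient (line zero σ) = deficient-unowned-line zero σ λ ()
    deficient (line (suc s) (steep r)) = deficient-unowned-line (suc s) (steep r) λ ()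
    deficient (line (suc s) (shallow c j)) line∈S with T? (S (to (line zero (shallow c j))))
    ... | yes origin∈S = deficient-unowned-line zero (shallow c j) (λ ()) origin∈S
    ... | no origin∉S = line (suc s) (shallow c j) , line∈S , inDegree-owned-line-without-origin s c j origin∉S

    inDegree≤k : ∀ w → inDegreeIn S w ≤ k
    inDegree≤k (point i a) = inDegree-point i a
    inDegree≤k (column j) = <⇒≤ (inDegree-column j)
    inDegree≤k (line s σ) = inDegree-line s σ

  madLessThan-2k : madLessThan graph (2 * k)
  madLessThan-2k = madLessThan-graph k inDegree≤k deficient

  degree≤D : ∀ v → degree v ≤ D
  degree≤D (point i a) = degree-point i a
  degree≤D (column i) = degree-column i
  degree≤D (line s σ) = degree-line s σ

  Δ≡D : Δ graph ≡ D
  Δ≡D = Δ≡-attained graph (degree≤D ∘ from) (to (column zero))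
    (subst (λ v → D ≤ degree v) (sym (Inverse.strictlyInverseʳ vertex↔ (column zero))) degree-column₀)

  incident⇒adjacent : ∀ {s σ i a} → Incident s σ i a → Adjacent (point i a) (line s σ)
  incident⇒adjacent {s} {σ} {i} on with Owns? i s σ
  ... | yes owns = inj₂ (line→point on)
  ... | no ¬owns = inj₁ (point→line on ¬owns)

  columns-adjacent : ∀ {i j} → i ≢ j → Adjacent (column i) (column j)
  columns-adjacent {i} {j} i≢j with <-cmp (toℕ i) (toℕ j)
  ... | tri< i<j _ _ = inj₁ (column→column i<j)
  ... | tri≈ _ i≡j _ = ⊥-elim (i≢j (toℕ-injective i≡j))
  ... | tri> _ _ j<i = inj₂ (column→column j<i)

  via-column : ∀ {i a b} → WithinTwo (point i a) (point i b)
  via-column {i} = inj₂ (column i , inj₂ column→point , inj₁ column→point)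

  common-line : ∀ {i i′ a b} s t → OnLine s t (toℕ i) a → OnLine s t (toℕ i′) b → WithinTwo (point i a) (point i′ b)
  common-line {i} {i′} {a} {b} s t on on′ =
    inj₂ (line s σ , incident⇒adjacent {s} {σ} (subst (λ t → OnLine s t (toℕ i) a) slope-σ on) ,
      Adjacent-sym (incident⇒adjacent {s} {σ} (subst (λ t → OnLine s t (toℕ i′) b) slope-σ on′)))
    where
    σ : Slope
    σ = fromSlope t
    slope-σ : t ≡ slope σ
    slope-σ = sym (Inverse.strictlyInverseˡ slope↔ t)

  via-line : Prime n → ∀ {i i′} a b → toℕ i < toℕ i′ → WithinTwo (point i a) (point i′ b)
  via-line n-prime {i} {i′} a b i<i′ = through (line-through n-prime (toℕ i) d (m<n⇒0<n∸m i<i′) d<n a b)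
    where
    d = toℕ i′ ∸ toℕ i
    d<n : d < n
    d<n = ≤-<-trans (m∸n≤m (toℕ i′) (toℕ i)) (<-≤-trans (toℕ<n i′) k≤n)
    through : (∃₂ λ s t → OnLine s t (toℕ i) a × OnLine s t (toℕ i + d) b) → WithinTwo (point i a) (point i′ b)
    through (s , t , on , on′) = common-line s t on (subst (λ x → OnLine s t x b) (m+[n∸m]≡n (<⇒≤ i<i′)) on′)

  points-within-two : Prime n → ∀ i a i′ b → WithinTwo (point i a) (point i′ b)
  points-within-two n-prime i a i′ b with <-cmp (toℕ i) (toℕ i′)
  ... | tri< i<i′ _ _ = via-line n-prime a b i<i′
  ... | tri> _ _ i′<i = WithinTwo-sym (via-line n-prime b a i′<i)
  ... | tri≈ _ i≡i′ _ with toℕ-injective {i = i} {i′} i≡i′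
  ...   | refl = via-column

  point-column-within-two : ∀ i a j → WithinTwo (point i a) (column j)
  point-column-within-two i a j with i ≟ j
  ... | yes refl = inj₁ (inj₂ column→point)
  ... | no i≢j = inj₂ (column i , inj₂ column→point , columns-adjacent i≢j)

  point-origin-within-two : ∀ i a c j → WithinTwo (point i a) (line zero (shallow c j))
  point-origin-within-two i a c j with intercept-exists (slope (shallow c j)) (toℕ i) a
  ... | zero , on = inj₁ (incident⇒adjacent on)
  ... | suc s , on = inj₂ (line (suc s) (shallow c j) , incident⇒adjacent on , inj₂ origin→line)

  column-origin-within-two : ∀ i c j → WithinTwo (column i) (line zero (shallow c j))
  column-origin-within-two i c j with value-exists zero (slope (shallow c j)) (toℕ i)
  ... | a , on = inj₂ (point i a , inj₁ column→point , incident⇒adjacent on)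

  origins-within-two : ∀ c j c′ j′ → WithinTwo (line zero (shallow c j)) (line zero (shallow c′ j′))
  origins-within-two c j c′ j′ = inj₂ (point zero zero ,
    Adjacent-sym (incident⇒adjacent (intercept-on-column₀ zero (slope (shallow c j)))) ,
    incident⇒adjacent (intercept-on-column₀ zero (slope (shallow c′ j′))))

  CoreIndex : Set
  CoreIndex = (Fin k × Fin n) ⊎ (Fin k ⊎ (Fin k × Fin k-1))

  core : CoreIndex → Vertex
  core (inj₁ (i , a)) = point i a
  core (inj₂ (inj₁ i)) = column i
  core (inj₂ (inj₂ (c , j))) = line zero (shallow c j)

  core-injective : ∀ {x y} → core x ≡ core y → x ≡ y
  core-injective {inj₁ _} {inj₁ _} refl = refl
  core-injective {inj₂ (inj₁ _)} {inj₂ (inj₁ _)} refl = refl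
  core-injective {inj₂ (inj₂ _)} {inj₂ (inj₂ _)} refl = refl
  core-injective {inj₁ _} {inj₂ (inj₁ _)} ()
  core-injective {inj₁ _} {inj₂ (inj₂ _)} ()
  core-injective {inj₂ (inj₁ _)} {inj₁ _} ()
  core-injective {inj₂ (inj₁ _)} {inj₂ (inj₂ _)} ()
  core-injective {inj₂ (inj₂ _)} {inj₁ _} ()
  core-injective {inj₂ (inj₂ _)} {inj₂ (inj₁ _)} ()

  core-within-two : Prime n → ∀ x y → x ≢ y → WithinTwo (core x) (core y)
  core-within-two n-prime (inj₁ (i , a)) (inj₁ (i′ , b)) _ = points-within-two n-prime i a i′ b
  core-within-two _ (inj₁ (i , a)) (inj₂ (inj₁ j)) _ = point-column-within-two i a j
  core-within-two _ (inj₁ (i , a)) (inj₂ (inj₂ (c , j))) _ = point-origin-within-two i a c j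
  core-within-two _ (inj₂ (inj₁ j)) (inj₁ (i , a)) _ = WithinTwo-sym (point-column-within-two i a j)
  core-within-two _ (inj₂ (inj₁ i)) (inj₂ (inj₁ j)) x≢y = inj₁ (columns-adjacent (x≢y ∘ cong (inj₂ ∘ inj₁)))
  core-within-two _ (inj₂ (inj₁ i)) (inj₂ (inj₂ (c , j))) _ = column-origin-within-two i c j
  core-within-two _ (inj₂ (inj₂ (c , j))) (inj₁ (i , a)) _ = WithinTwo-sym (point-origin-within-two i a c j)
  core-within-two _ (inj₂ (inj₂ (c , j))) (inj₂ (inj₁ i)) _ = WithinTwo-sym (column-origin-within-two i c j)
  core-within-two _ (inj₂ (inj₂ (c , j))) (inj₂ (inj₂ (c′ , j′))) _ = origins-within-two c j c′ j′

  coreIndex↔ : Fin (k * n + (k + F)) ↔ CoreIndex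
  coreIndex↔ = ↔-trans +↔⊎₃ (*↔× ⊎-↔ (↔-refl ⊎-↔ *↔×))

  squareClique-core : Prime n → HasSquareClique graph (k * n + (k + F))
  squareClique-core n-prime = squareClique (core ∘ Inverse.to coreIndex↔)
    (↔-to-injective coreIndex↔ ∘ core-injective)
    (λ x y x≢y → core-within-two n-prime _ _ (x≢y ∘ ↔-to-injective coreIndex↔))

  clique-size : k * D + k ≡ k * n + (k + F)
  clique-size = lemma k n k-1
    where
    lemma : ∀ k n k-1 → k * (n + k-1) + k ≡ k * n + (k + k * k-1)
    lemma = solve-∀

  witness : Prime n → Σ Graph λ G →
    (Δ G ≡ n + k ∸ 1) × madLessThan G (2 * k) × HasSquareClique G (k * Δ G + k) × χ²≥ G (k * Δ G + k)
  witness n-prime = graph , trans Δ≡D (sym (+-suc n-1 k-1)) , madLessThan-2k , clique , clique⇒χ²≥ graph _ clique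
    where
    clique : HasSquareClique graph (k * Δ graph + k)
    clique = subst (HasSquareClique graph) (sym (trans (cong (λ d → k * d + k) Δ≡D) clique-size)) (squareClique-core n-prime)

mainTheorem4 : (k n : ℕ) → 3 ≤ k → Prime n → k * k ∸ k ≤ n →
    Σ Graph λ G →
      (Δ G ≡ n + k ∸ 1) × madLessThan G (2 * k)
      × HasSquareClique G (k * Δ G + k) × χ²≥ G (k * Δ G + k)
mainTheorem4 k@(suc (suc k-2)) n (s≤s (s≤s _)) n-prime k²-k≤n with n ∸ k * suc k-2 | m+[n∸m]≡n F≤n
  where
  F≤n : k * suc k-2 ≤ n
  F≤n = subst (_≤ n) (trans (cong (k * k ∸_) (sym (*-identityʳ k))) (sym (*-distribˡ-∸ k k 1))) k²-k≤n
... | m₀ | refl = Construction.witness k-2 m₀ n-prime
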